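{- Let $K_n$ be the complete graph with vertex set $V=\{1,\ldots,n\}$. Then the intervals $[\{v\}\setminus Int(\{v\});\,\{v\}\cup Ext(\{v\})]$, $v\in V$, are pairwise disjoint and their union is $2^V$.
   Context: The labels give the linear order on $V$; $N(v)$ is the neighbourhood of $v$. For an independent set $A$: $Ext(A)=\{u\in V\setminus A:\ \exists a\in A,\ a\in N(u),\ u>a\}$; for $u\in A$, $Subs(u)=\{w\in N(u): (A\setminus\{u\})\cup\{w\}\text{ independent}\}$, $u$ is internally active if $Subs(u)=\emptyset$ or $u>\max Subs(u)$; $Int(A)$ is the set of internally active vertices of $A$. $[X;Y]=\{Z: X\subseteq Z\subseteq Y\}$. (The maximal independent sets of $K_n$ are the singletons.) -}

module Defs where

open import Data.Nat using (ℕ)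
open import Data.Fin using (Fin; _<_)
open import Data.Fin.Subset using (Subset; _∈_; _∉_; ⁅_⁆)
open import Data.Product using (_×_; ∃-syntax)
open import Data.Sum using (_⊎_)
open import Relation.Nullary using (¬_)
open import Relation.Binary.PropositionalEquality using (_≡_; _≢_)

-- A graph on the vertex set Fin n, given by its adjacency relation.
-- The linear order on vertices is the order of Fin n (labels 1..n ↦ 0..n-1,
-- order preserving).
Graph : ℕ → Set₁
Graph n = Fin n → Fin n → Set

K : (n : ℕ) → Graph n
K n u v = u ≢ v

module _ {n : ℕ} (G : Graph n) where

  IndependentP : (Fin n → Set) → Set
  IndependentP P = ∀ u v → P u → P v → ¬ G u v

  Independent : Subset n → Set
  Independent A = IndependentP (λ x → x ∈ A)

  InExt : Subset n → Fin n → Set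
  InExt A u = u ∉ A × ∃[ a ] (a ∈ A × G u a × a < u)

  InSubs : Subset n → Fin n → Fin n → Set
  InSubs A u w = G u w × IndependentP (λ x → ((x ∈ A) × (x ≢ u)) ⊎ (x ≡ w))

  -- u ∈ Int(A): u ∈ A and (Subs(u) = ∅ or u > max Subs(u)),
  -- i.e. every element of Subs(u) is smaller than u.
  InInt : Subset n → Fin n → Set
  InInt A u = u ∈ A × (∀ w → InSubs A u w → w < u)

  InInterval : Subset n → Subset n → Set
  InInterval A Z =
    (∀ x → x ∈ A → ¬ InInt A x → x ∈ Z) ×
    (∀ x → x ∈ Z → x ∈ A ⊎ InExt A x)

-- In K_n every other vertex is a neighbour of v and can replace it, so for the singleton {v}
-- we get Ext({v}) = {u : u > v}, and v is internally active exactly when it is the largest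
-- vertex.  Hence Z lies in the interval of v iff v is a lower bound of Z and either v ∈ Z
-- or v is the largest vertex: a non-empty Z lies only in the interval of its minimum, the
-- empty set only in the interval of the largest vertex.
module Submission where

open import Defs
open import Data.Nat using (ℕ; _≤_; s≤s; z≤n; suc)
open import Data.Nat.Properties using (<⇒≤)
open import Data.Fin using (Fin; fromℕ; zero; suc) renaming (_<_ to _<ᶠ_; _≤_ to _≤ᶠ_)
open import Data.Fin.Properties using (<-irrefl; ≤fromℕ; ≤∧≢⇒<; ≤-antisym; ≤-refl; _≟_; _≤?_; all?)
open import Data.Fin.Subset using (Subset; ⁅_⁆; _∈_; _∉_; Empty; inside; outside)
open import Data.Fin.Subset.Properties using (x∈⁅x⁆; x∈⁅y⁆⇒x≡y; _∈?_)
open import Data.Product using (_×_; ∃-syntax; _,_)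
open import Data.Sum using (_⊎_; inj₁; inj₂)
open import Data.Vec using (_∷_; []; here; there)
open import Function.Bundles using (_⇔_; mk⇔; Equivalence)
open import Relation.Nullary using (¬_; yes; no; contradiction)
open import Relation.Nullary.Decidable using (decidable-stable)
open import Relation.Binary.PropositionalEquality using (_≡_; refl; sym; _≢_; subst)

IsMax : ∀ {n} → Fin n → Set
IsMax {n} v = (w : Fin n) → w ≤ᶠ v

LowerBound : ∀ {n} → Fin n → Subset n → Set
LowerBound v Z = ∀ x → x ∈ Z → v ≤ᶠ x

minimum-or-empty : ∀ {n} (Z : Subset n) → Empty Z ⊎ ∃[ v ] (v ∈ Z × LowerBound v Z)
minimum-or-empty []            = inj₁ λ ()
minimum-or-empty (inside ∷ Z)  = inj₂ (zero , here , λ _ _ → z≤n)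
minimum-or-empty (outside ∷ Z) with minimum-or-empty Z
... | inj₁ empty = inj₁ λ { (suc x , there x∈Z) → empty (x , x∈Z) }
... | inj₂ (v , v∈Z , v≤Z) =
  inj₂ (suc v , there v∈Z , λ { (suc x) (there x∈Z) → s≤s (v≤Z x x∈Z) })

module _ {n : ℕ} {v : Fin n} where

  inInt⇔isMax : InInt (K n) ⁅ v ⁆ v ⇔ IsMax v
  inInt⇔isMax = mk⇔ to from
    where
    swap-in : (w : Fin n) → IndependentP (K n) (λ x → ((x ∈ ⁅ v ⁆) × (x ≢ v)) ⊎ (x ≡ w))
    swap-in w x y (inj₁ (x∈v , x≢v)) _ _ = x≢v (x∈⁅y⁆⇒x≡y v x∈v)
    swap-in w x y (inj₂ _) (inj₁ (y∈v , y≢v)) _ = y≢v (x∈⁅y⁆⇒x≡y v y∈v)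
    swap-in w x y (inj₂ refl) (inj₂ refl) x≢y = x≢y refl

    to : InInt (K n) ⁅ v ⁆ v → IsMax v
    to (_ , below) w with w ≟ v
    ... | yes refl = ≤-refl
    ... | no w≢v   = <⇒≤ (below w ((λ v≡w → w≢v (sym v≡w)) , swap-in w))

    from : IsMax v → InInt (K n) ⁅ v ⁆ v
    from max = x∈⁅x⁆ v , λ w (v≢w , _) → ≤∧≢⇒< (max w) (λ w≡v → v≢w (sym w≡v))

  inExt⇔> : ∀ {x} → InExt (K n) ⁅ v ⁆ x ⇔ v <ᶠ x
  inExt⇔> {x} = mk⇔ to from
    where
    to : InExt (K n) ⁅ v ⁆ x → v <ᶠ x
    to (_ , a , a∈v , _ , a<x) = subst (_<ᶠ x) (x∈⁅y⁆⇒x≡y v a∈v) a<x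

    from : v <ᶠ x → InExt (K n) ⁅ v ⁆ x
    from v<x = x∉v , v , x∈⁅x⁆ v , x≢v , v<x
      where
      x≢v : x ≢ v
      x≢v refl = <-irrefl refl v<x
      x∉v : x ∉ ⁅ v ⁆
      x∉v x∈v = x≢v (x∈⁅y⁆⇒x≡y v x∈v)

  inInterval⇔ : ∀ {Z} → InInterval (K n) ⁅ v ⁆ Z ⇔ (LowerBound v Z × (v ∈ Z ⊎ IsMax v))
  inInterval⇔ {Z} = mk⇔ to from
    where
    to : InInterval (K n) ⁅ v ⁆ Z → LowerBound v Z × (v ∈ Z ⊎ IsMax v)
    to (lower , upper) = v≤Z , v∈Z⊎max
      where
      v≤Z : LowerBound v Z
      v≤Z x x∈Z with upper x x∈Z
      ... | inj₁ x∈v   = subst (v ≤ᶠ_) (sym (x∈⁅y⁆⇒x≡y v x∈v)) ≤-refl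
      ... | inj₂ x∈ext = <⇒≤ (Equivalence.to inExt⇔> x∈ext)
      -- v is internally active unless it is forced into Z; activity is decidable
      v∈Z⊎max : v ∈ Z ⊎ IsMax v
      v∈Z⊎max with v ∈? Z
      ... | yes v∈Z = inj₁ v∈Z
      ... | no  v∉Z = inj₂ (decidable-stable (all? (_≤? v)) λ ¬max →
        v∉Z (lower v (x∈⁅x⁆ v) λ int → ¬max (Equivalence.to inInt⇔isMax int)))

    from : LowerBound v Z × (v ∈ Z ⊎ IsMax v) → InInterval (K n) ⁅ v ⁆ Z
    from (v≤Z , v∈Z⊎max) = lower v∈Z⊎max , upper
      where
      lower : v ∈ Z ⊎ IsMax v → ∀ x → x ∈ ⁅ v ⁆ → ¬ InInt (K n) ⁅ v ⁆ x → x ∈ Z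
      lower v∈Z⊎max x x∈v ¬int with refl ← x∈⁅y⁆⇒x≡y v x∈v with v∈Z⊎max
      ... | inj₁ v∈Z = v∈Z
      ... | inj₂ max = contradiction (Equivalence.from inInt⇔isMax max) ¬int
      upper : ∀ x → x ∈ Z → x ∈ ⁅ v ⁆ ⊎ InExt (K n) ⁅ v ⁆ x
      upper x x∈Z with x ≟ v
      ... | yes refl = inj₁ (x∈⁅x⁆ v)
      ... | no x≢v   =
        inj₂ (Equivalence.from inExt⇔> (≤∧≢⇒< (v≤Z x x∈Z) λ v≡x → x≢v (sym v≡x)))

lowerBound≤ : ∀ {n} {v w : Fin n} {Z} → LowerBound v Z → w ∈ Z ⊎ IsMax w → v ≤ᶠ w
lowerBound≤ v≤Z (inj₁ w∈Z) = v≤Z _ w∈Z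
lowerBound≤ _   (inj₂ max) = max _

theorem7 : (n : ℕ) → 1 ≤ n →
    ((v w : Fin n) (Z : Subset n) →
        InInterval (K n) ⁅ v ⁆ Z → InInterval (K n) ⁅ w ⁆ Z → v ≡ w)
    × ((Z : Subset n) → ∃[ v ] InInterval (K n) ⁅ v ⁆ Z)
theorem7 (suc m) _ = disjoint , cover
  where
  disjoint : (v w : Fin (suc m)) (Z : Subset (suc m)) →
    InInterval (K (suc m)) ⁅ v ⁆ Z → InInterval (K (suc m)) ⁅ w ⁆ Z → v ≡ w
  disjoint v w Z inV inW with Equivalence.to inInterval⇔ inV | Equivalence.to inInterval⇔ inW
  ... | v≤Z , v∈Z⊎max | w≤Z , w∈Z⊎max =
    ≤-antisym (lowerBound≤ v≤Z w∈Z⊎max) (lowerBound≤ w≤Z v∈Z⊎max)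

  cover : (Z : Subset (suc m)) → ∃[ v ] InInterval (K (suc m)) ⁅ v ⁆ Z
  cover Z with minimum-or-empty Z
  ... | inj₁ empty =
    fromℕ m , Equivalence.from inInterval⇔ ((λ x x∈Z → contradiction (x , x∈Z) empty) , inj₂ ≤fromℕ)
  ... | inj₂ (v , v∈Z , v≤Z) = v , Equivalence.from inInterval⇔ (v≤Z , inj₁ v∈Z)
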